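{- With $v_1,v_2,v_3$ as in the context, for all $n\ge 0$ and all $1\le j<i\le 3$, $$v_i(n+1)-v_j(n+1)-\big(v_i(n)-v_j(n)\big)\ge i-j.$$
   Context: $\mathbb{N}_0$ denotes the non-negative integers. For $F\subset\mathbb{N}_0$ let $\mathrm{Mex}(F)=\min(\mathbb{N}_0\setminus F)$, and $a+D=\{a+d:d\in D\}$. Define recursively: $G_0=\{(0,0,0)\}$, $v_1(0)=v_2(0)=v_3(0)=0$; for $n\ge 0$, let $F_n$ be the set of all coordinates of all triples in $G_n$, $D_n=\bigcup_{x\in G_n}\{x_2-x_1,x_3-x_2,x_3-x_1\}$, and $v_1(n+1)=\mathrm{Mex}(F_n)$, $v_2(n+1)=\mathrm{Mex}\big((v_1(n+1)+D_n)\cup\{1,\dots,v_1(n+1)\}\cup F_n\big)$, $v_3(n+1)=\mathrm{Mex}\big((v_2(n+1)+D_n)\cup\{1,\dots,v_2(n+1)\}\cup F_n\big)$, $G_{n+1}=G_n\cup\{(v_1(n+1),v_2(n+1),v_3(n+1))\}$. -}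

module Defs where

open import Data.Nat using (ℕ; zero; suc; _+_; _∸_; _≤ᵇ_; _≡ᵇ_)
open import Data.Bool using (Bool; true; false; if_then_else_; _∨_)
open import Data.List using (List; []; _∷_; _++_; length; concatMap; upTo; map)
open import Data.Bool.ListAction using (any)
open import Data.Fin using (Fin; zero; suc)
open import Data.Product using (_×_; _,_)

Triple : Set
Triple = ℕ × ℕ × ℕ

_∈ᵇ_ : ℕ → List ℕ → Bool
k ∈ᵇ L = any (k ≡ᵇ_) L

-- Mex of a finite set (given as a list): least natural not in the list.
-- The search from 0 with fuel (length L + 1) is exhaustive, since some
-- k ≤ length L is missing from L (pigeonhole).
mex : List ℕ → ℕ
mex L = go (suc (length L)) 0
  where
  go : ℕ → ℕ → ℕ
  go zero    k = k
  go (suc f) k = if k ∈ᵇ L then go f (suc k) else k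

coords : List Triple → List ℕ
coords = concatMap (λ { (x₁ , x₂ , x₃) → x₁ ∷ x₂ ∷ x₃ ∷ [] })

-- The natural numbers in  a + {q - p}  for a pair (p , q) (integer difference);
-- if a + (q - p) is negative it is not a natural number, so contributes nothing.
-- (When p ≤ q, a + (q - p) = a + (q ∸ p); when q < p, a + q - p ≥ 0 iff p ≤ a + q.)
shiftDiff : ℕ → ℕ → ℕ → List ℕ
shiftDiff a p q = if p ≤ᵇ a + q then ((a + q) ∸ p) ∷ [] else []

shiftD : ℕ → List Triple → List ℕ
shiftD a = concatMap (λ { (x₁ , x₂ , x₃) →
  shiftDiff a x₁ x₂ ++ shiftDiff a x₂ x₃ ++ shiftDiff a x₁ x₃ })

oneTo : ℕ → List ℕ
oneTo a = map suc (upTo a)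

excl : ℕ → List Triple → List ℕ
excl a G = shiftD a G ++ oneTo a ++ coords G

step : List Triple → Triple
step G =
  let w₁ = mex (coords G)
      w₂ = mex (excl w₁ G)
      w₃ = mex (excl w₂ G)
  in w₁ , w₂ , w₃

Gs : ℕ → List Triple
Gs zero    = (0 , 0 , 0) ∷ []
Gs (suc n) = Gs n ++ (step (Gs n) ∷ [])

vtriple : ℕ → Triple
vtriple zero    = 0 , 0 , 0
vtriple (suc n) = step (Gs n)

v : Fin 3 → ℕ → ℕ
v zero             n with vtriple n
... | (a , _ , _) = a
v (suc zero)       n with vtriple n
... | (_ , b , _) = b
v (suc (suc zero)) n with vtriple n
... | (_ , _ , c) = c

-- With d₂₁, d₃₂, d₃₁ the differences inside the n-th triple we have d₃₁ = d₂₁ + d₃₂,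
-- so it suffices that d₂₁ and d₃₂ increase strictly. This follows from the invariant
-- that D_n contains every e ≤ d₂₁(n) and every e ≤ d₃₂(n): the mex defining v₂(n+1)
-- avoids v₁(n+1) + D_n, so d₂₁(n+1) ∉ D_n and hence exceeds every earlier d₂₁; likewise
-- for d₃₂. In particular v₃ grows by at least 3 and d₃₁ by at least 2 per step.
-- To propagate the invariant, note that for e below d₂₁(n+1) (resp. d₃₂(n+1)) the number
-- v₁(n+1) + e (resp. v₂(n+1) + e) lies below a mex, hence in the excluded set, which
-- forces e ∈ D_n except when v₁(n+1) + e is some v₃(k). In that case e ≤ d₃₂(n+1): if
-- m := d₃₂(n+1) < e, then m ∉ D_n makes v₁(n+1) + m a v₃-value as well, so by the gap 3
-- between v₃-values both m+1 and m+2 lie in D_n; lying above the non-difference m they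
-- can only be d₃₁-values, and two consecutive d₃₁-values contradict the gap 2.

module Submission where

open import Defs

module Sequence where
  open import Data.Nat
  open import Data.Nat.Properties
  open import Data.Nat.Induction using (<-rec)
  open import Data.Bool using (true; false; T; if_then_else_)
  open import Data.Unit using (tt)
  open import Data.List using (List; []; _∷_; _++_; length; lookup; map)
  open import Data.List.Membership.Propositional using (_∈_; _∉_; find; lose)
  open import Data.List.Membership.Propositional.Properties
    using (∈-++⁺ˡ; ∈-++⁺ʳ; ∈-++⁻; ∈-concatMap⁺; ∈-concatMap⁻; ∈-map⁺; ∈-map⁻; ∈-upTo⁺; ∈-upTo⁻)
  open import Data.List.Relation.Unary.Any as Any using (here; there)
  open import Data.List.Relation.Unary.Any.Properties using (any⁺; any⁻; lookup-index)
  open import Data.Fin using (Fin; zero; suc; toℕ)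
  open import Data.Fin.Properties using (injective⇒≤; toℕ-injective; toℕ<n)
  open import Data.Product using (∃-syntax; _×_; _,_; proj₁; proj₂)
  open import Data.Sum as Sum using (_⊎_; inj₁; inj₂)
  open import Data.Empty using (⊥-elim)
  open import Function using (_∘_; case_of_)
  open import Relation.Nullary using (¬_)
  open import Relation.Binary.PropositionalEquality
  open import Algebra.Properties.CommutativeSemigroup +-commutativeSemigroup using (interchange; x∙yz≈y∙xz)
  open import Relation.Binary.Definitions using (tri<; tri≈; tri>)

  ∈ᵇ⇒∈ : ∀ {k L} → T (k ∈ᵇ L) → k ∈ L
  ∈ᵇ⇒∈ {k} {L} = Any.map (λ {x} → ≡ᵇ⇒≡ k x) ∘ any⁻ (k ≡ᵇ_) L

  ∈⇒∈ᵇ : ∀ {k L} → k ∈ L → T (k ∈ᵇ L)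
  ∈⇒∈ᵇ {k} = any⁺ (k ≡ᵇ_) ∘ Any.map (λ {x} → ≡⇒≡ᵇ k x)

  covered⇒≤length : ∀ {r} {L : List ℕ} → (∀ {y} → y < r → y ∈ L) → r ≤ length L
  covered⇒≤length {r} {L} covered = injective⇒≤ position-injective
    where
    position : Fin r → Fin (length L)
    position i = Any.index (covered (toℕ<n i))

    position-injective : ∀ {i j} → position i ≡ position j → i ≡ j
    position-injective {i} {j} eq = toℕ-injective (begin
      toℕ i                  ≡⟨ lookup-index (covered (toℕ<n i)) ⟩
      lookup L (position i)  ≡⟨ cong (lookup L) eq ⟩
      lookup L (position j)  ≡⟨ lookup-index (covered (toℕ<n j)) ⟨
      toℕ j                  ∎)
      where open ≡-Reasoning

  module Search (L : List ℕ) where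
    -- `mex` runs a local search function that cannot be named from outside;
    -- `search` is solved to it by unification against `mex-unfold`.
    mutual
      search : ℕ → ℕ → ℕ
      search = _

      mex-unfold : mex L ≡ (if 0 ∈ᵇ L then search (length L) 1 else 0)
      mex-unfold with length L | 1
      ... | _ | _ = refl

    search-correct : ∀ f k → (∀ {y} → y < k → y ∈ L) →
      (∀ {y} → y < search f k → y ∈ L) × (search f k ∉ L ⊎ search f k ≡ k + f)
    search-correct zero    k below = below , inj₂ (sym (+-identityʳ k))
    search-correct (suc f) k below with k ∈ᵇ L in k∈ᵇL
    ... | false = below , inj₁ (λ k∈L → subst T k∈ᵇL (∈⇒∈ᵇ k∈L))
    ... | true  =
      let below″ , stop = search-correct f (suc k) below′
      in  below″ , Sum.map₂ (λ eq → trans eq (sym (+-suc k f))) stop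
      where
      below′ : ∀ {y} → y < suc k → y ∈ L
      below′ y<1+k with m<1+n⇒m<n∨m≡n y<1+k
      ... | inj₁ y<k  = below y<k
      ... | inj₂ refl = ∈ᵇ⇒∈ (subst T (sym k∈ᵇL) tt)

    mex-correct : (∀ {y} → y < mex L → y ∈ L) × mex L ∉ L
    mex-correct rewrite mex-unfold
      with search-correct (suc (length L)) 0 (λ ())
    ... | below , inj₁ ∉L = below , ∉L
    ... | below , inj₂ exhausted =
      ⊥-elim (<-irrefl refl (covered⇒≤length (below ∘ subst (_ <_) (sym exhausted))))

  <mex⇒∈ : ∀ {L y} → y < mex L → y ∈ L
  <mex⇒∈ {L} = proj₁ (Search.mex-correct L)

  mex∉ : ∀ L → mex L ∉ L
  mex∉ L = proj₂ (Search.mex-correct L)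

  ≤⇒∈⇒<mex : ∀ {L x} → (∀ {y} → y ≤ x → y ∈ L) → x < mex L
  ≤⇒∈⇒<mex {L} below = ≰⇒> (mex∉ L ∘ below)

  v₁ v₂ v₃ : ℕ → ℕ
  v₁ = v zero
  v₂ = v (suc zero)
  v₃ = v (suc (suc zero))

  F : ℕ → List ℕ
  F n = coords (Gs n)

  entries : ℕ → List ℕ
  entries k = v₁ k ∷ v₂ k ∷ v₃ k ∷ []

  ∈Gs⁻ : ∀ n {x} → x ∈ Gs n → ∃[ k ] k ≤ n × x ≡ vtriple k
  ∈Gs⁻ zero    (here refl) = 0 , z≤n , refl
  ∈Gs⁻ (suc n) x∈ with ∈-++⁻ (Gs n) x∈
  ... | inj₁ x∈Gsn with k , k≤n , refl ← ∈Gs⁻ n x∈Gsn = k , m≤n⇒m≤1+n k≤n , refl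
  ... | inj₂ (here refl) = suc n , ≤-refl , refl

  vtriple∈Gs : ∀ {k n} → k ≤ n → vtriple k ∈ Gs n
  vtriple∈Gs {n = zero}  z≤n = here refl
  vtriple∈Gs {k} {suc n} k≤1+n with m≤n⇒m<n∨m≡n k≤1+n
  ... | inj₁ k<1+n = ∈-++⁺ˡ (vtriple∈Gs (s≤s⁻¹ k<1+n))
  ... | inj₂ refl  = ∈-++⁺ʳ (Gs n) (here refl)

  ∈F⁻ : ∀ {n x} → x ∈ F n → ∃[ k ] k ≤ n × x ∈ entries k
  ∈F⁻ {n} x∈ with find (∈-concatMap⁻ _ x∈)
  ... | t , t∈ , x∈t with ∈Gs⁻ n t∈
  ...   | k , k≤n , refl = k , k≤n , x∈t

  ∈F⁺ : ∀ {k n x} → k ≤ n → x ∈ entries k → x ∈ F n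
  ∈F⁺ k≤n x∈ = ∈-concatMap⁺ _ (lose (vtriple∈Gs k≤n) x∈)

  F-mono : ∀ {m n x} → m ≤ n → x ∈ F m → x ∈ F n
  F-mono m≤n x∈ with k , k≤m , x∈k ← ∈F⁻ x∈ = ∈F⁺ (≤-trans k≤m m≤n) x∈k

  ≤⇒∈excl : ∀ {a n y} → y ≤ a → y ∈ excl a (Gs n)
  ≤⇒∈excl {a} {n} {zero}  _ =
    ∈-++⁺ʳ (shiftD a (Gs n)) (∈-++⁺ʳ (oneTo a) (∈F⁺ {n = n} z≤n (here refl)))
  ≤⇒∈excl {a} {n} {suc y} 1+y≤a =
    ∈-++⁺ʳ (shiftD a (Gs n)) (∈-++⁺ˡ (∈-map⁺ suc (∈-upTo⁺ 1+y≤a)))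

  v₁≤v₂ : ∀ k → v₁ k ≤ v₂ k
  v₁≤v₂ zero    = z≤n
  v₁≤v₂ (suc n) = <⇒≤ (≤⇒∈⇒<mex (≤⇒∈excl {n = n}))

  v₂≤v₃ : ∀ k → v₂ k ≤ v₃ k
  v₂≤v₃ zero    = z≤n
  v₂≤v₃ (suc n) = <⇒≤ (≤⇒∈⇒<mex (≤⇒∈excl {n = n}))

  <v₁⇒∈F : ∀ {k n y} → k ≤ n → y < v₁ k → y ∈ F n
  <v₁⇒∈F {suc k} 1+k≤n y<v₁ = F-mono (≤-trans (n≤1+n k) 1+k≤n) (<mex⇒∈ y<v₁)

  v₁<v₁-suc : ∀ {k n} → k ≤ n → v₁ k < v₁ (suc n)
  v₁<v₁-suc k≤n = ≤⇒∈⇒<mex λ y≤v₁ → case m≤n⇒m<n∨m≡n y≤v₁ of λ where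
    (inj₁ y<v₁) → <v₁⇒∈F k≤n y<v₁
    (inj₂ refl) → ∈F⁺ k≤n (here refl)

  v₁≤v₃ : ∀ k → v₁ k ≤ v₃ k
  v₁≤v₃ k = ≤-trans (v₁≤v₂ k) (v₂≤v₃ k)

  d₂₁ d₃₂ d₃₁ : ℕ → ℕ
  d₂₁ k = v₂ k ∸ v₁ k
  d₃₂ k = v₃ k ∸ v₂ k
  d₃₁ k = v₃ k ∸ v₁ k

  diffs : ℕ → List ℕ
  diffs k = d₂₁ k ∷ d₃₂ k ∷ d₃₁ k ∷ []

  D : ℕ → ℕ → Set
  D n e = ∃[ k ] k ≤ n × e ∈ diffs k

  D-mono : ∀ {m n e} → m ≤ n → D m e → D n e
  D-mono m≤n (k , k≤m , e∈) = k , ≤-trans k≤m m≤n , e∈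

  0∈D : ∀ {n} → D n 0
  0∈D = 0 , z≤n , here refl

  v₂≡v₁+d₂₁ : ∀ k → v₂ k ≡ v₁ k + d₂₁ k
  v₂≡v₁+d₂₁ k = sym (m+[n∸m]≡n (v₁≤v₂ k))

  v₃≡v₂+d₃₂ : ∀ k → v₃ k ≡ v₂ k + d₃₂ k
  v₃≡v₂+d₃₂ k = sym (m+[n∸m]≡n (v₂≤v₃ k))

  v₃≡v₁+[d₂₁+d₃₂] : ∀ k → v₃ k ≡ v₁ k + (d₂₁ k + d₃₂ k)
  v₃≡v₁+[d₂₁+d₃₂] k = begin
    v₃ k                      ≡⟨ v₃≡v₂+d₃₂ k ⟩
    v₂ k + d₃₂ k              ≡⟨ cong (_+ d₃₂ k) (v₂≡v₁+d₂₁ k) ⟩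
    v₁ k + d₂₁ k + d₃₂ k      ≡⟨ +-assoc (v₁ k) (d₂₁ k) (d₃₂ k) ⟩
    v₁ k + (d₂₁ k + d₃₂ k)    ∎
    where open ≡-Reasoning

  d₃₁≡d₂₁+d₃₂ : ∀ k → d₃₁ k ≡ d₂₁ k + d₃₂ k
  d₃₁≡d₂₁+d₃₂ k = begin
    v₃ k ∸ v₁ k                      ≡⟨ cong (_∸ v₁ k) (v₃≡v₁+[d₂₁+d₃₂] k) ⟩
    v₁ k + (d₂₁ k + d₃₂ k) ∸ v₁ k    ≡⟨ m+n∸m≡n (v₁ k) _ ⟩
    d₂₁ k + d₃₂ k                    ∎
    where open ≡-Reasoning

  <d₂₁⇒v₁+<v₂ : ∀ {k e} → e < d₂₁ k → v₁ k + e < v₂ k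
  <d₂₁⇒v₁+<v₂ {k} {e} e<d₂₁ = subst (v₁ k + e <_) (sym (v₂≡v₁+d₂₁ k)) (+-monoʳ-< (v₁ k) e<d₂₁)

  <d₃₂⇒v₂+<v₃ : ∀ {k e} → e < d₃₂ k → v₂ k + e < v₃ k
  <d₃₂⇒v₂+<v₃ {k} {e} e<d₃₂ = subst (v₂ k + e <_) (sym (v₃≡v₂+d₃₂ k)) (+-monoʳ-< (v₂ k) e<d₃₂)

  shiftDiff-≤ : ∀ a {p q} → p ≤ q → shiftDiff a p q ≡ (a + (q ∸ p)) ∷ []
  shiftDiff-≤ a {p} {q} p≤q with p ≤ᵇ a + q in p≤ᵇa+q
  ... | true  = cong (_∷ []) (+-∸-assoc a p≤q)
  ... | false = ⊥-elim (subst T p≤ᵇa+q (≤⇒≤ᵇ (≤-trans p≤q (m≤n+m q a))))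

  shiftDiffs : ∀ a k →
    shiftDiff a (v₁ k) (v₂ k) ++ shiftDiff a (v₂ k) (v₃ k) ++ shiftDiff a (v₁ k) (v₃ k)
      ≡ map (a +_) (diffs k)
  shiftDiffs a k
    rewrite shiftDiff-≤ a (v₁≤v₂ k) | shiftDiff-≤ a (v₂≤v₃ k) | shiftDiff-≤ a (v₁≤v₃ k) = refl

  ∈shiftD⁻ : ∀ {a n x} → x ∈ shiftD a (Gs n) → ∃[ e ] D n e × x ≡ a + e
  ∈shiftD⁻ {a} {n} x∈ with find (∈-concatMap⁻ _ x∈)
  ... | t , t∈ , x∈t with ∈Gs⁻ n t∈
  ...   | k , k≤n , refl with ∈-map⁻ (a +_) (subst (_ ∈_) (shiftDiffs a k) x∈t)
  ...     | e , e∈ , x≡a+e = e , (k , k≤n , e∈) , x≡a+e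

  ∈shiftD⁺ : ∀ {a n e} → D n e → a + e ∈ shiftD a (Gs n)
  ∈shiftD⁺ {a} (k , k≤n , e∈) =
    ∈-concatMap⁺ _ (lose (vtriple∈Gs k≤n) (subst (_ ∈_) (sym (shiftDiffs a k)) (∈-map⁺ (a +_) e∈)))

  ∈excl⁺ : ∀ {a n e} → D n e → a + e ∈ excl a (Gs n)
  ∈excl⁺ e∈D = ∈-++⁺ˡ (∈shiftD⁺ e∈D)

  ∈excl⁻ : ∀ {a n e} → a + e ∈ excl a (Gs n) → D n e ⊎ a + e ∈ F n
  ∈excl⁻ {a} {n} {e} a+e∈ with ∈-++⁻ (shiftD a (Gs n)) a+e∈
  ... | inj₁ a+e∈shift with ∈shiftD⁻ a+e∈shift
  ...   | e′ , e′∈D , a+e≡a+e′ = inj₁ (subst (D n) (sym (+-cancelˡ-≡ a e e′ a+e≡a+e′)) e′∈D)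
  ∈excl⁻ {a} {n} {e} a+e∈ | inj₂ a+e∈rest with ∈-++⁻ (oneTo a) a+e∈rest
  ... | inj₂ a+e∈F = inj₂ a+e∈F
  ... | inj₁ a+e∈oneTo with ∈-map⁻ suc a+e∈oneTo
  ...   | y , y∈ , a+e≡1+y = inj₁ (subst (D n) (sym e≡0) 0∈D)
    where
    e≡0 : e ≡ 0
    e≡0 = n≤0⇒n≡0 (+-cancelˡ-≤ a e 0 (subst₂ _≤_ (sym a+e≡1+y) (sym (+-identityʳ a)) (∈-upTo⁻ y∈)))

  d₂₁-suc∉D : ∀ n → ¬ D n (d₂₁ (suc n))
  d₂₁-suc∉D n d∈D = mex∉ E (subst (_∈ E) (sym (v₂≡v₁+d₂₁ (suc n))) (∈excl⁺ d∈D))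
    where E = excl (v₁ (suc n)) (Gs n)

  d₃₂-suc∉D : ∀ n → ¬ D n (d₃₂ (suc n))
  d₃₂-suc∉D n d∈D = mex∉ E (subst (_∈ E) (sym (v₃≡v₂+d₃₂ (suc n))) (∈excl⁺ d∈D))
    where E = excl (v₂ (suc n)) (Gs n)

  Saturated : ℕ → Set
  Saturated k = (∀ {e} → e ≤ d₂₁ k → D k e) × (∀ {e} → e ≤ d₃₂ k → D k e)

  SaturatedUpTo : ℕ → Set
  SaturatedUpTo p = ∀ {k} → k ≤ p → Saturated k

  d₂₁<d₂₁-suc : ∀ {p j} → SaturatedUpTo p → j ≤ p → d₂₁ j < d₂₁ (suc p)
  d₂₁<d₂₁-suc {p} sat j≤p = ≰⇒> (d₂₁-suc∉D p ∘ D-mono j≤p ∘ proj₁ (sat j≤p))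

  d₃₂<d₃₂-suc : ∀ {p j} → SaturatedUpTo p → j ≤ p → d₃₂ j < d₃₂ (suc p)
  d₃₂<d₃₂-suc {p} sat j≤p = ≰⇒> (d₃₂-suc∉D p ∘ D-mono j≤p ∘ proj₂ (sat j≤p))

  +-mono-≤-offset : ∀ m n {a b c d} → m + a ≤ c → n + b ≤ d → (m + n) + (a + b) ≤ c + d
  +-mono-≤-offset m n {a} {b} {c} {d} m+a≤c n+b≤d =
    subst (_≤ c + d) (interchange m a n b) (+-mono-≤ m+a≤c n+b≤d)

  saturatedUpTo-≤ : ∀ {m p} → m ≤ p → SaturatedUpTo p → SaturatedUpTo m
  saturatedUpTo-≤ m≤p sat k≤m = sat (≤-trans k≤m m≤p)

  d₃₁-step : ∀ {p j k} → SaturatedUpTo p → j < k → k ≤ p → 2 + d₃₁ j ≤ d₃₁ k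
  d₃₁-step {j = j} {suc k} sat (s≤s j≤k) 1+k≤p =
    subst₂ _≤_ (cong (2 +_) (sym (d₃₁≡d₂₁+d₃₂ j))) (sym (d₃₁≡d₂₁+d₃₂ (suc k)))
      (+-mono-≤-offset 1 1 (d₂₁<d₂₁-suc sat′ j≤k) (d₃₂<d₃₂-suc sat′ j≤k))
    where
    sat′ : SaturatedUpTo k
    sat′ = saturatedUpTo-≤ (≤-trans (n≤1+n k) 1+k≤p) sat

  v₃-step : ∀ {p j k} → SaturatedUpTo p → j < k → k ≤ p → 3 + v₃ j ≤ v₃ k
  v₃-step {j = j} {suc k} sat (s≤s j≤k) 1+k≤p =
    subst₂ _≤_ (cong (3 +_) (sym (v₃≡v₁+[d₂₁+d₃₂] j))) (sym (v₃≡v₁+[d₂₁+d₃₂] (suc k)))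
      (+-mono-≤-offset 1 2 (v₁<v₁-suc j≤k)
        (+-mono-≤-offset 1 1 (d₂₁<d₂₁-suc sat′ j≤k) (d₃₂<d₃₂-suc sat′ j≤k)))
    where
    sat′ : SaturatedUpTo k
    sat′ = saturatedUpTo-≤ (≤-trans (n≤1+n k) 1+k≤p) sat

  step⇒gap : ∀ (f : ℕ → ℕ) g {p} → (∀ {j k} → j < k → k ≤ p → g + f j ≤ f k) →
    ∀ {j k} → j ≤ p → k ≤ p → f j < f k → g + f j ≤ f k
  step⇒gap f g step {j} {k} j≤p k≤p fj<fk with <-cmp j k
  ... | tri< j<k _ _  = step j<k k≤p
  ... | tri≈ _ refl _ = ⊥-elim (<-irrefl refl fj<fk)
  ... | tri> _ _ k<j  = ⊥-elim (<⇒≱ fj<fk (≤-trans (m≤n+m (f k) g) (step k<j j≤p)))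

  m+n≡o+p⇒m≤o⇒p≤n : ∀ {m n o p} → m + n ≡ o + p → m ≤ o → p ≤ n
  m+n≡o+p⇒m≤o⇒p≤n {m} {n} {o} {p} eq m≤o =
    +-cancelˡ-≤ m p n (≤-trans (+-monoˡ-≤ p m≤o) (≤-reflexive (sym eq)))

  module SaturationStep {p} (sat : SaturatedUpTo p) where
    n : ℕ
    n = suc p

    v₂<v₂-suc : ∀ {k} → k ≤ p → v₂ k < v₂ n
    v₂<v₂-suc {k} k≤p = subst₂ _<_ (sym (v₂≡v₁+d₂₁ k)) (sym (v₂≡v₁+d₂₁ n))
      (+-mono-< (v₁<v₁-suc k≤p) (d₂₁<d₂₁-suc sat k≤p))

    ∈F-≥v₁ : ∀ {x} → x ∈ F p → v₁ n ≤ x → ∃[ k ] k ≤ p × (x ≡ v₂ k ⊎ x ≡ v₃ k)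
    ∈F-≥v₁ x∈F v₁≤x with ∈F⁻ x∈F
    ... | k , k≤p , here refl                 = ⊥-elim (<⇒≱ (v₁<v₁-suc k≤p) v₁≤x)
    ... | k , k≤p , there (here refl)         = k , k≤p , inj₁ refl
    ... | k , k≤p , there (there (here refl)) = k , k≤p , inj₂ refl

    ∈F-≥v₂ : ∀ {x} → x ∈ F p → v₂ n ≤ x → ∃[ k ] k ≤ p × x ≡ v₃ k
    ∈F-≥v₂ x∈F v₂≤x with ∈F-≥v₁ x∈F (≤-trans (v₁≤v₂ n) v₂≤x)
    ... | k , k≤p , inj₁ refl = ⊥-elim (<⇒≱ (v₂<v₂-suc k≤p) v₂≤x)
    ... | k , k≤p , inj₂ x≡v₃ = k , k≤p , x≡v₃

    <d₃₂⇒∈D : ∀ {e} → e < d₃₂ n → D p e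
    <d₃₂⇒∈D {e} e<d₃₂ with ∈excl⁻ (<mex⇒∈ (<d₃₂⇒v₂+<v₃ {n} e<d₃₂))
    ... | inj₁ e∈D = e∈D
    ... | inj₂ v₂+e∈F with ∈F-≥v₂ v₂+e∈F (m≤m+n (v₂ n) e)
    ...   | k , k≤p , v₂+e≡v₃ = D-mono k≤p (proj₂ (sat k≤p) e≤d₃₂)
      where
      e≤d₃₂ : e ≤ d₃₂ k
      e≤d₃₂ = m+n≡o+p⇒m≤o⇒p≤n (trans (sym (v₃≡v₂+d₃₂ k)) (sym v₂+e≡v₃)) (<⇒≤ (v₂<v₂-suc k≤p))

    <d₂₁⇒∈D⊎v₃ : ∀ {e} → e < d₂₁ n → D p e ⊎ ∃[ k ] k ≤ p × v₁ n + e ≡ v₃ k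
    <d₂₁⇒∈D⊎v₃ {e} e<d₂₁ with ∈excl⁻ (<mex⇒∈ (<d₂₁⇒v₁+<v₂ {n} e<d₂₁))
    ... | inj₁ e∈D = inj₁ e∈D
    ... | inj₂ v₁+e∈F with ∈F-≥v₁ v₁+e∈F (m≤m+n (v₁ n) e)
    ...   | k , k≤p , inj₂ v₁+e≡v₃ = inj₂ (k , k≤p , v₁+e≡v₃)
    ...   | k , k≤p , inj₁ v₁+e≡v₂ = inj₁ (D-mono k≤p (proj₁ (sat k≤p) e≤d₂₁))
      where
      e≤d₂₁ : e ≤ d₂₁ k
      e≤d₂₁ = m+n≡o+p⇒m≤o⇒p≤n (trans (sym (v₂≡v₁+d₂₁ k)) (sym v₁+e≡v₂)) (<⇒≤ (v₁<v₁-suc k≤p))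

    above-non-D⇒d₃₁ : ∀ {m x} → ¬ D p m → m ≤ x → D p x → ∃[ j ] j ≤ p × x ≡ d₃₁ j
    above-non-D⇒d₃₁ m∉D m≤x (j , j≤p , here refl) =
      ⊥-elim (m∉D (D-mono j≤p (proj₁ (sat j≤p) m≤x)))
    above-non-D⇒d₃₁ m∉D m≤x (j , j≤p , there (here refl)) =
      ⊥-elim (m∉D (D-mono j≤p (proj₂ (sat j≤p) m≤x)))
    above-non-D⇒d₃₁ m∉D m≤x (j , j≤p , there (there (here refl))) = j , j≤p , refl

    v₃-offsets-gap : ∀ {x y j k} → j ≤ p → k ≤ p →
      v₁ n + x ≡ v₃ j → v₁ n + y ≡ v₃ k → x < y → 3 + x ≤ y
    v₃-offsets-gap {x} {y} {j} {k} j≤p k≤p v₁+x≡v₃ v₁+y≡v₃ x<y =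
      +-cancelˡ-≤ (v₁ n) (3 + x) y (begin
      v₁ n + (3 + x)  ≡⟨ x∙yz≈y∙xz (v₁ n) 3 x ⟩
      3 + (v₁ n + x)  ≡⟨ cong (3 +_) v₁+x≡v₃ ⟩
      3 + v₃ j        ≤⟨ step⇒gap v₃ 3 (v₃-step sat) j≤p k≤p v₃<v₃ ⟩
      v₃ k            ≡⟨ v₁+y≡v₃ ⟨
      v₁ n + y        ∎)
      where
      open ≤-Reasoning
      v₃<v₃ : v₃ j < v₃ k
      v₃<v₃ = subst₂ _<_ v₁+x≡v₃ v₁+y≡v₃ (+-monoʳ-< (v₁ n) x<y)

    near-v₃-offset⇒d₃₁ : ∀ {m k x} → ¬ D p m → k ≤ p → v₁ n + m ≡ v₃ k →
      m < x → x < 3 + m → x < d₂₁ n → ∃[ j ] j ≤ p × x ≡ d₃₁ j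
    near-v₃-offset⇒d₃₁ m∉D k≤p v₁+m≡v₃ m<x x<3+m x<d₂₁ with <d₂₁⇒∈D⊎v₃ x<d₂₁
    ... | inj₁ x∈D = above-non-D⇒d₃₁ m∉D (<⇒≤ m<x) x∈D
    ... | inj₂ (k′ , k′≤p , v₁+x≡v₃) =
      ⊥-elim (<⇒≱ x<3+m (v₃-offsets-gap k≤p k′≤p v₁+m≡v₃ v₁+x≡v₃ m<x))

    d₃₁-nonconsecutive : ∀ {x j₁ j₂} → j₁ ≤ p → j₂ ≤ p → x ≡ d₃₁ j₁ → suc x ≢ d₃₁ j₂
    d₃₁-nonconsecutive j₁≤p j₂≤p x≡d₃₁ 1+x≡d₃₁ =
      <-irrefl refl (subst₂ _≤_ (cong (2 +_) (sym x≡d₃₁)) (sym 1+x≡d₃₁)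
        (step⇒gap d₃₁ 2 (d₃₁-step sat) j₁≤p j₂≤p (subst₂ _<_ x≡d₃₁ 1+x≡d₃₁ ≤-refl)))

    d₃₂<e<d₂₁⇒v₁+e≢v₃ : ∀ {e k} → d₃₂ n < e → e < d₂₁ n → k ≤ p → v₁ n + e ≢ v₃ k
    d₃₂<e<d₂₁⇒v₁+e≢v₃ {e} m<e e<d₂₁ k≤p v₁+e≡v₃ with <d₂₁⇒∈D⊎v₃ (<-trans m<e e<d₂₁)
    ... | inj₁ m∈D = d₃₂-suc∉D p m∈D
    ... | inj₂ (k′ , k′≤p , v₁+m≡v₃) =
      let j₁ , j₁≤p , 1+m≡d₃₁ = near-d₃₁ ≤-refl (n≤1+n _)
          j₂ , j₂≤p , 2+m≡d₃₁ = near-d₃₁ (n≤1+n _) ≤-refl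
      in  d₃₁-nonconsecutive j₁≤p j₂≤p 1+m≡d₃₁ 2+m≡d₃₁
      where
      m : ℕ
      m = d₃₂ n

      near-d₃₁ : ∀ {x} → m < x → x < 3 + m → ∃[ j ] j ≤ p × x ≡ d₃₁ j
      near-d₃₁ m<x x<3+m = near-v₃-offset⇒d₃₁ (d₃₂-suc∉D p) k′≤p v₁+m≡v₃ m<x x<3+m
        (<-trans (<-≤-trans x<3+m (v₃-offsets-gap k′≤p k≤p v₁+m≡v₃ v₁+e≡v₃ m<e)) e<d₂₁)

    saturated-suc : Saturated n
    saturated-suc = ≤d₂₁⇒∈D , ≤d₃₂⇒∈D
      where
      ≤d₃₂⇒∈D : ∀ {e} → e ≤ d₃₂ n → D n e
      ≤d₃₂⇒∈D e≤d₃₂ with m≤n⇒m<n∨m≡n e≤d₃₂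
      ... | inj₁ e<d₃₂ = D-mono (n≤1+n p) (<d₃₂⇒∈D e<d₃₂)
      ... | inj₂ refl  = n , ≤-refl , there (here refl)

      ≤d₂₁⇒∈D : ∀ {e} → e ≤ d₂₁ n → D n e
      ≤d₂₁⇒∈D e≤d₂₁ with m≤n⇒m<n∨m≡n e≤d₂₁
      ... | inj₂ refl  = n , ≤-refl , here refl
      ... | inj₁ e<d₂₁ with <d₂₁⇒∈D⊎v₃ e<d₂₁
      ...   | inj₁ e∈D = D-mono (n≤1+n p) e∈D
      ...   | inj₂ (k , k≤p , v₁+e≡v₃) =
        ≤d₃₂⇒∈D (≮⇒≥ λ d₃₂<e → d₃₂<e<d₂₁⇒v₁+e≢v₃ d₃₂<e e<d₂₁ k≤p v₁+e≡v₃)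

  saturated : ∀ n → Saturated n
  saturated = <-rec Saturated λ where
    zero    _   → (λ { z≤n → 0∈D }) , (λ { z≤n → 0∈D })
    (suc p) sat → SaturationStep.saturated-suc (λ k≤p → sat (s≤s k≤p))

  saturatedUpTo : ∀ p → SaturatedUpTo p
  saturatedUpTo p {k} _ = saturated k

  d₂₁-increasing : ∀ n → d₂₁ n < d₂₁ (suc n)
  d₂₁-increasing n = d₂₁<d₂₁-suc (saturatedUpTo n) ≤-refl

  d₃₂-increasing : ∀ n → d₃₂ n < d₃₂ (suc n)
  d₃₂-increasing n = d₃₂<d₃₂-suc (saturatedUpTo n) ≤-refl

  2+d₃₁≤d₃₁-suc : ∀ n → 2 + d₃₁ n ≤ d₃₁ (suc n)
  2+d₃₁≤d₃₁-suc n = d₃₁-step (saturatedUpTo (suc n)) (n<1+n n) ≤-refl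

open Sequence using (v₁≤v₂; v₂≤v₃; v₁≤v₃; d₂₁-increasing; d₃₂-increasing; 2+d₃₁≤d₃₁-suc)

open import Data.Nat using (ℕ; suc)
import Data.Nat as ℕ
import Data.Nat.Properties as ℕ
open import Data.Fin using (Fin; zero; suc; toℕ; _<_)
open import Data.Integer using (+_; _-_; _≤_; +≤+)
open import Data.Integer.Properties using ([+m]-[+n]≡m⊖n; ⊖-≥)
open import Relation.Binary.PropositionalEquality using (_≡_; trans)

+m-+n≡+[m∸n] : ∀ {m n} → n ℕ.≤ m → + m - + n ≡ + (m ℕ.∸ n)
+m-+n≡+[m∸n] {m} {n} n≤m = trans ([+m]-[+n]≡m⊖n m n) (⊖-≥ n≤m)

difference-growth : ∀ k {a b a′ b′} → a ℕ.≤ b → a′ ℕ.≤ b′ →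
  k ℕ.+ (b ℕ.∸ a) ℕ.≤ b′ ℕ.∸ a′ → + k ≤ (+ b′ - + a′) - (+ b - + a)
difference-growth k a≤b a′≤b′ growth
  rewrite +m-+n≡+[m∸n] a≤b | +m-+n≡+[m∸n] a′≤b′ | +m-+n≡+[m∸n] (ℕ.m+n≤o⇒n≤o k growth)
  = +≤+ (ℕ.m+n≤o⇒m≤o∸n k growth)

corollary4 : ∀ (n : ℕ) (i j : Fin 3) → j < i →
    (+ (toℕ i)) - (+ (toℕ j)) ≤ ((+ v i (suc n)) - (+ v j (suc n))) - ((+ v i n) - (+ v j n))
corollary4 n (suc zero) zero _ =
  difference-growth 1 (v₁≤v₂ n) (v₁≤v₂ (suc n)) (d₂₁-increasing n)
corollary4 n (suc (suc zero)) (suc zero) _ =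
  difference-growth 1 (v₂≤v₃ n) (v₂≤v₃ (suc n)) (d₃₂-increasing n)
corollary4 n (suc (suc zero)) zero _ =
  difference-growth 2 (v₁≤v₃ n) (v₁≤v₃ (suc n)) (2+d₃₁≤d₃₁-suc n)
corollary4 n zero             _                ()
corollary4 n (suc zero)       (suc _)          (ℕ.s≤s ())
corollary4 n (suc (suc zero)) (suc (suc _))    (ℕ.s≤s (ℕ.s≤s ()))
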